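{- Let $S=\{s_1,\dots,s_t\}$ with $1\le s_1<s_2<\dots<s_t$ integers and $\gcd(s_1,\dots,s_t)=1$, and let $k\in\langle S\rangle$, $k>0$. If the generalized greedy representation of $k$ has exactly one nonzero coordinate, then it is a minimal representation of $k$, i.e. $\mathrm{GreedyCost}_S(k)=\mathrm{MinCost}_S(k)$.
   Context: $\langle S\rangle=\{\sum_i a_i s_i : a_i\in\mathbb{N}_0\}$. A representation of $k\in\langle S\rangle$ is a vector $(a_1,\dots,a_t)\in\mathbb{N}_0^t$ with $\sum_i a_i s_i=k$; its cost is $\sum_i a_i$; $\mathrm{MinCost}_S(k)$ is the minimum cost over all representations, and a minimal representation is one attaining it. The (generalized) greedy representation of $k\in\langle S\rangle$, $k>0$: set $r:=k$; for $i=t,\dots,1$ let $a_i$ be the largest integer $q\ge0$ with $r-qs_i\in\langle S\rangle$ and replace $r$ by $r-a_is_i$; $\mathrm{GreedyCost}_S(k)=\sum_i a_i$. -}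

module Defs where

open import Data.Nat using (ℕ; zero; suc; _+_; _*_; _∸_; _≤_; _<_)
open import Data.Nat.GCD using (gcd)
open import Data.Fin using (Fin; toℕ)
open import Data.Vec.Functional using (Vector; foldr)
open import Data.Product using (Σ; _×_; ∃)
open import Relation.Nullary using (¬_; Dec; yes; no)
open import Relation.Binary.PropositionalEquality using (_≡_)
open import Data.Nat using (_<ᵇ_)
open import Data.Bool using (if_then_else_)

-- Generators s : Fin t → ℕ, where s i is s_{i+1} (0-based indices).
-- Representations are vectors a : Fin t → ℕ.

Σᶠ : ∀ {t} → (Fin t → ℕ) → ℕ
Σᶠ = foldr _+_ 0

value : ∀ {t} → (Fin t → ℕ) → (Fin t → ℕ) → ℕ
value s a = Σᶠ (λ i → a i * s i)

cost : ∀ {t} → (Fin t → ℕ) → ℕ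
cost a = Σᶠ a

gcdAll : ∀ {t} → (Fin t → ℕ) → ℕ
gcdAll = foldr gcd 0

StrictlyIncreasing : ∀ {t} → (Fin t → ℕ) → Set
StrictlyIncreasing s = ∀ i j → toℕ i < toℕ j → s i < s j

IsRep : ∀ {t} → (Fin t → ℕ) → ℕ → (Fin t → ℕ) → Set
IsRep s k a = value s a ≡ k

InSemigroup : ∀ {t} → (Fin t → ℕ) → ℕ → Set
InSemigroup s k = ∃ λ a → IsRep s k a

IsMinimalRep : ∀ {t} → (Fin t → ℕ) → ℕ → (Fin t → ℕ) → Set
IsMinimalRep s k a = IsRep s k a × (∀ b → IsRep s k b → cost a ≤ cost b)

-- Σ_{j > i} a_j s_j : the amount already removed before step i
-- (the greedy algorithm processes indices from the top down)
valueAbove : ∀ {t} → (Fin t → ℕ) → (Fin t → ℕ) → Fin t → ℕ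
valueAbove s a i = Σᶠ (λ j → if toℕ i <ᵇ toℕ j then a j * s j else 0)

-- a is the generalized greedy representation of k: for each i (from t down to 1),
-- with r the current remainder k - Σ_{j>i} a_j s_j, a_i is the largest q ≥ 0
-- with r - q s_i ∈ ⟨S⟩ (in particular q s_i ≤ r), and r is replaced by r - a_i s_i.
IsGreedyRep : ∀ {t} → (Fin t → ℕ) → ℕ → (Fin t → ℕ) → Set
IsGreedyRep s k a =
  ∀ i → valueAbove s a i ≤ k
      × a i * s i ≤ k ∸ valueAbove s a i
      × InSemigroup s ((k ∸ valueAbove s a i) ∸ a i * s i)
      × (∀ q → q * s i ≤ k ∸ valueAbove s a i
             → InSemigroup s ((k ∸ valueAbove s a i) ∸ q * s i)
             → q ≤ a i)

ExactlyOneNonzero : ∀ {t} → (Fin t → ℕ) → Set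
ExactlyOneNonzero a = ∃ λ i → ¬ (a i ≡ 0) × (∀ j → ¬ (j ≡ i) → a j ≡ 0)

{-# OPTIONS --safe #-}
module Submission where

-- The greedy representation a is always a representation of k: if the leftover r = k - value a
-- were positive, some generator s_j would fit into r with r - s_j ∈ ⟨S⟩, and then step j of the
-- greedy algorithm could have taken one more copy of s_j.  If a = a_i e_i, no representation b
-- of k uses a generator s_j with j > i (step j, whose remainder is still k, would have taken it),
-- so k = Σ b_j s_j ≤ cost b · s_i, while k = a_i s_i.

open import Defs
open import Data.Nat using (ℕ; _≤_; _<_)
open import Data.Fin using (Fin)
open import Relation.Binary.PropositionalEquality using (_≡_)

open import Data.Bool using (true; false; if_then_else_; T)
open import Data.Bool.Properties using (if-float; T-≡)
open import Data.Empty using (⊥-elim)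
open import Data.Fin using (toℕ; punchIn) renaming (zero to fzero; suc to fsuc)
open import Data.Fin.Properties using (toℕ-injective; punchInᵢ≢i)
open import Data.Nat using (zero; suc; pred; _+_; _*_; _∸_; _<ᵇ_; _≡ᵇ_; z≤n; z<s; >-nonZero; >-nonZero⁻¹)
open import Data.Nat.Properties
open import Algebra.Properties.Semiring.Sum +-*-semiring
  using (sum-cong-≗; sum-replicate-zero; sum-remove; ∑-distrib-+; *-distribʳ-sum)
open import Data.Product using (∃; _×_; _,_; proj₂; uncurry)
open import Data.Sum using (inj₁; inj₂)
open import Data.Vec.Functional using (updateAt; removeAt)
open import Data.Vec.Functional.Properties using (updateAt-updates; updateAt-minimal)
open import Function.Bundles using (Equivalence)
open import Relation.Nullary using (¬_; yes; no)
open import Relation.Binary.PropositionalEquality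
  using (_≢_; refl; sym; trans; cong; cong₂; subst; module ≡-Reasoning)

private
  variable
    t m : ℕ

Σᶠ-mono-≤ : {f g : Fin t → ℕ} → (∀ j → f j ≤ g j) → Σᶠ f ≤ Σᶠ g
Σᶠ-mono-≤ {zero}  f≤g = z≤n
Σᶠ-mono-≤ {suc t} f≤g = +-mono-≤ (f≤g fzero) (Σᶠ-mono-≤ (λ j → f≤g (fsuc j)))

Σᶠ-zero : {f : Fin t → ℕ} → (∀ j → f j ≡ 0) → Σᶠ f ≡ 0
Σᶠ-zero {t} f≡0 = trans (sum-cong-≗ f≡0) (sum-replicate-zero t)

0<Σᶠ⇒0<some : (f : Fin t → ℕ) → 0 < Σᶠ f → ∃ λ j → 0 < f j
0<Σᶠ⇒0<some {suc t} f 0<Σ with f fzero in eq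
... | suc _ = fzero , subst (0 <_) (sym eq) z<s
... | zero with 0<Σᶠ⇒0<some (λ j → f (fsuc j)) 0<Σ
...   | j , 0<fj = fsuc j , 0<fj

Σᶠ-differ-at : {f g : Fin t → ℕ} (i : Fin t) (x : ℕ)
             → (∀ j → j ≢ i → f j ≡ g j) → f i ≡ x + g i → Σᶠ f ≡ x + Σᶠ g
Σᶠ-differ-at {suc t} {f} {g} i x f≡g fi≡x+gi = begin
  Σᶠ f                          ≡⟨ sum-remove {i = i} f ⟩
  f i + Σᶠ (removeAt f i)       ≡⟨ cong₂ _+_ fi≡x+gi (sum-cong-≗ λ j → f≡g (punchIn i j) (punchInᵢ≢i i j)) ⟩
  x + g i + Σᶠ (removeAt g i)   ≡⟨ +-assoc x (g i) _ ⟩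
  x + (g i + Σᶠ (removeAt g i)) ≡⟨ cong (x +_) (sum-remove {i = i} g) ⟨
  x + Σᶠ g                      ∎
  where open ≡-Reasoning

Σᶠ-single : (f : Fin t → ℕ) (i : Fin t) → (∀ j → j ≢ i → f j ≡ 0) → Σᶠ f ≡ f i
Σᶠ-single {t} f i f≡0 = trans (Σᶠ-differ-at i (f i) f≡0 (sym (+-identityʳ (f i))))
                          (trans (cong (f i +_) (sum-replicate-zero t)) (+-identityʳ (f i)))

if-then-0 : ∀ b {x : ℕ} → (T b → x ≡ 0) → (if b then x else 0) ≡ 0
if-then-0 true  x≡0 = x≡0 _
if-then-0 false _   = refl

value-+ : (s a b : Fin t → ℕ) → value s (λ j → a j + b j) ≡ value s a + value s b
value-+ s a b = trans (sum-cong-≗ λ j → *-distribʳ-+ (s j) (a j) (b j))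
                      (∑-distrib-+ (λ j → a j * s j) (λ j → b j * s j))

InSemigroup-+ : (s : Fin t → ℕ) {x y : ℕ} → InSemigroup s x → InSemigroup s y → InSemigroup s (x + y)
InSemigroup-+ s (a , refl) (b , refl) = (λ j → a j + b j) , value-+ s a b

value≤cost*bound : (s b : Fin t → ℕ) → (∀ j → 0 < b j → s j ≤ m) → value s b ≤ cost b * m
value≤cost*bound {m = m} s b used≤m =
  ≤-trans (Σᶠ-mono-≤ term≤) (≤-reflexive (sym (*-distribʳ-sum m b)))
  where
  term≤ : ∀ j → b j * s j ≤ b j * m
  term≤ j with b j in eq
  ... | zero  = z≤n
  ... | suc n = *-monoʳ-≤ (suc n) (used≤m j (subst (0 <_) (sym eq) z<s))

used-generator-∸ : (s b : Fin t → ℕ) (j : Fin t) → IsRep s m b → 0 < b j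
                 → s j ≤ m × InSemigroup s (m ∸ s j)
used-generator-∸ s b j refl 0<bj =
  subst (s j ≤_) (sym value-b≡) (m≤m+n (s j) (value s c)) ,
  c , sym (trans (cong (_∸ s j) value-b≡) (m+n∸m≡n (s j) (value s c)))
  where
  c : Fin _ → ℕ
  c = updateAt b j pred
  value-b≡ : value s b ≡ s j + value s c
  value-b≡ = Σᶠ-differ-at j (s j)
    (λ l l≢j → cong (_* s l) (sym (updateAt-minimal l j b l≢j)))
    (begin
      b j * s j               ≡⟨ cong (_* s j) (suc-pred (b j) {{>-nonZero 0<bj}}) ⟨
      s j + pred (b j) * s j  ≡⟨ cong (λ x → s j + x * s j) (updateAt-updates j b) ⟨
      s j + c j * s j         ∎)
    where open ≡-Reasoning

InSemigroup-irreducible⇒0 : (s : Fin t → ℕ) → InSemigroup s m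
                          → (∀ j → s j ≤ m → ¬ InSemigroup s (m ∸ s j)) → m ≡ 0
InSemigroup-irreducible⇒0 {m = zero}  s _ _ = refl
InSemigroup-irreducible⇒0 {m = suc m} s (b , b-rep) irreducible
  with 0<Σᶠ⇒0<some (λ j → b j * s j) (subst (0 <_) (sym b-rep) z<s)
... | j , 0<bjsj = ⊥-elim (uncurry (irreducible j) (used-generator-∸ s b j b-rep 0<bj))
  where
  0<bj : 0 < b j
  0<bj = >-nonZero⁻¹ (b j) {{m*n≢0⇒m≢0 (b j) {{>-nonZero 0<bjsj}}}}

increasing⇒monotone : {s : Fin t → ℕ} → StrictlyIncreasing s → ∀ i j → toℕ i ≤ toℕ j → s i ≤ s j
increasing⇒monotone increasing i j i≤j with m≤n⇒m<n∨m≡n i≤j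
... | inj₁ i<j = <⇒≤ (increasing i j i<j)
... | inj₂ i≡j = ≤-reflexive (cong _ (toℕ-injective i≡j))

valueBelow : (s a : Fin t → ℕ) → Fin t → ℕ
valueBelow s a j = Σᶠ (λ l → if toℕ l <ᵇ toℕ j then a l * s l else 0)

valueBelow-∈ : (s a : Fin t → ℕ) (j : Fin t) → InSemigroup s (valueBelow s a j)
valueBelow-∈ s a j = (λ l → if toℕ l <ᵇ toℕ j then a l else 0)
                   , sum-cong-≗ λ l → if-float (_* s l) (toℕ l <ᵇ toℕ j)

<ᵇ-trichotomy : ∀ m n x → x ≡ (if m <ᵇ n then x else 0) + ((if n ≡ᵇ m then x else 0) + (if n <ᵇ m then x else 0))
<ᵇ-trichotomy zero    zero    x = sym (+-identityʳ x)
<ᵇ-trichotomy zero    (suc n) x = sym (+-identityʳ x)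
<ᵇ-trichotomy (suc m) zero    x = refl
<ᵇ-trichotomy (suc m) (suc n) x = <ᵇ-trichotomy m n x

value-split : (s a : Fin t → ℕ) (j : Fin t) → value s a ≡ valueAbove s a j + (a j * s j + valueBelow s a j)
value-split s a j = begin
  value s a                                       ≡⟨ sum-cong-≗ (λ l → <ᵇ-trichotomy (toℕ j) (toℕ l) (a l * s l)) ⟩
  Σᶠ (λ l → above l + (at l + below l))           ≡⟨ ∑-distrib-+ above (λ l → at l + below l) ⟩
  valueAbove s a j + Σᶠ (λ l → at l + below l)    ≡⟨ cong (valueAbove s a j +_) (∑-distrib-+ at below) ⟩
  valueAbove s a j + (Σᶠ at + valueBelow s a j)   ≡⟨ cong (λ x → valueAbove s a j + (x + valueBelow s a j)) Σat ⟩
  valueAbove s a j + (a j * s j + valueBelow s a j) ∎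
  where
  open ≡-Reasoning
  above at below : Fin _ → ℕ
  above l = if toℕ j <ᵇ toℕ l then a l * s l else 0
  at    l = if toℕ l ≡ᵇ toℕ j then a l * s l else 0
  below l = if toℕ l <ᵇ toℕ j then a l * s l else 0
  Σat : Σᶠ at ≡ a j * s j
  Σat = trans (Σᶠ-single at j λ l l≢j → if-then-0 (toℕ l ≡ᵇ toℕ j) λ l≡j → ⊥-elim (l≢j (toℕ-injective (≡ᵇ⇒≡ _ _ l≡j))))
              (cong (if_then a j * s j else 0) (Equivalence.to T-≡ (≡⇒≡ᵇ (toℕ j) (toℕ j) refl)))

valueAbove-zero : (s a : Fin t → ℕ) (j : Fin t) → (∀ l → toℕ j < toℕ l → a l ≡ 0) → valueAbove s a j ≡ 0
valueAbove-zero s a j a≡0 =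
  Σᶠ-zero λ l → if-then-0 (toℕ j <ᵇ toℕ l) λ j<l → cong (_* s l) (a≡0 l (<ᵇ⇒< _ _ j<l))

remainder-split : ∀ {k A c} → A ≤ k → c ≤ k ∸ A → A + c + (k ∸ A ∸ c) ≡ k
remainder-split {A = A} A≤k c≤k-A = trans (+-assoc A _ _) (trans (cong (A +_) (m+[n∸m]≡n c≤k-A)) (m+[n∸m]≡n A≤k))

module _ {s : Fin t → ℕ} {k : ℕ} {a : Fin t → ℕ} (greedy : IsGreedyRep s k a) where

  private
    remainder : Fin t → ℕ
    remainder j = k ∸ valueAbove s a j

    greedy-maximal : ∀ j q → q * s j ≤ remainder j → InSemigroup s (remainder j ∸ q * s j) → q ≤ a j
    greedy-maximal j = proj₂ (proj₂ (proj₂ (greedy j)))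

  greedy-cannot-add : ∀ j {R} → remainder j ≡ a j * s j + R → s j ≤ R → ¬ InSemigroup s (R ∸ s j)
  greedy-cannot-add j {R} remainder≡ sj≤R R-sj∈S =
    1+n≰n (greedy-maximal j (suc (a j)) fits rest∈S)
    where
    fits : s j + a j * s j ≤ remainder j
    fits = subst (s j + a j * s j ≤_) (sym remainder≡)
                 (≤-trans (≤-reflexive (+-comm (s j) (a j * s j))) (+-monoʳ-≤ (a j * s j) sj≤R))
    rest∈S : InSemigroup s (remainder j ∸ (s j + a j * s j))
    rest∈S = subst (InSemigroup s) (sym (begin
      remainder j ∸ (s j + a j * s j)         ≡⟨ cong₂ _∸_ remainder≡ (+-comm (s j) (a j * s j)) ⟩
      (a j * s j + R) ∸ (a j * s j + s j)     ≡⟨ [m+n]∸[m+o]≡n∸o (a j * s j) R (s j) ⟩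
      R ∸ s j                                 ∎)) R-sj∈S
      where open ≡-Reasoning

  greedy-leftover-irreducible : ∀ {r} → value s a + r ≡ k → ∀ j → s j ≤ r → ¬ InSemigroup s (r ∸ s j)
  greedy-leftover-irreducible {r} value+r≡k j sj≤r r-sj∈S =
    greedy-cannot-add j remainder≡ (≤-trans sj≤r (m≤n+m r B)) (subst (InSemigroup s) (sym (+-∸-assoc B sj≤r))
      (InSemigroup-+ s (valueBelow-∈ s a j) r-sj∈S))
    where
    open ≡-Reasoning
    A B : ℕ
    A = valueAbove s a j
    B = valueBelow s a j
    remainder≡ : remainder j ≡ a j * s j + (B + r)
    remainder≡ = begin
      k ∸ A                          ≡⟨ cong (_∸ A) value+r≡k ⟨
      value s a + r ∸ A              ≡⟨ cong (λ x → x + r ∸ A) (value-split s a j) ⟩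
      A + (a j * s j + B) + r ∸ A    ≡⟨ cong (_∸ A) (+-assoc A _ r) ⟩
      A + (a j * s j + B + r) ∸ A    ≡⟨ m+n∸m≡n A _ ⟩
      a j * s j + B + r              ≡⟨ +-assoc (a j * s j) B r ⟩
      a j * s j + (B + r)            ∎

  greedy-positive : ∀ j → (∀ l → toℕ j < toℕ l → a l ≡ 0) → s j ≤ k → InSemigroup s (k ∸ s j) → a j ≢ 0
  greedy-positive j above≡0 sj≤k k-sj∈S aj≡0 = greedy-cannot-add j remainder≡ sj≤k k-sj∈S
    where
    remainder≡ : remainder j ≡ a j * s j + k
    remainder≡ = trans (cong (k ∸_) (valueAbove-zero s a j above≡0)) (cong (λ x → x * s j + k) (sym aj≡0))

greedy-isRep : {s a : Fin t → ℕ} {k : ℕ} → InSemigroup s k → IsGreedyRep s k a → IsRep s k a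
greedy-isRep {zero}  (_ , refl) _ = refl
greedy-isRep {suc t} {s} {a} {k} _ greedy with greedy fzero
... | A≤k , c≤k-A , r∈S , _ = begin
  value s a      ≡⟨ +-identityʳ (value s a) ⟨
  value s a + 0  ≡⟨ cong (value s a +_) r≡0 ⟨
  value s a + r  ≡⟨ value+r≡k ⟩
  k              ∎
  where
  open ≡-Reasoning
  A c r : ℕ
  A = valueAbove s a fzero
  c = a fzero * s fzero
  r = k ∸ A ∸ c
  value+r≡k : value s a + r ≡ k
  value+r≡k = begin
    value s a + r                           ≡⟨ cong (_+ r) (value-split s a fzero) ⟩
    A + (c + valueBelow s a fzero) + r      ≡⟨ cong (λ x → A + (c + x) + r) (Σᶠ-zero {suc t} λ _ → refl) ⟩
    A + (c + 0) + r                         ≡⟨ cong (λ x → A + x + r) (+-identityʳ c) ⟩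
    A + c + r                               ≡⟨ remainder-split A≤k c≤k-A ⟩
    k                                       ∎
  r≡0 : r ≡ 0
  r≡0 = InSemigroup-irreducible⇒0 s r∈S (greedy-leftover-irreducible greedy value+r≡k)

lemma2 : (t : ℕ) (s : Fin t → ℕ)
           → (∀ i → 1 ≤ s i)
           → StrictlyIncreasing s
           → gcdAll s ≡ 1
           → (k : ℕ) → 0 < k → InSemigroup s k
           → (a : Fin t → ℕ) → IsGreedyRep s k a
           → ExactlyOneNonzero a
           → IsMinimalRep s k a
lemma2 t s 1≤s increasing _ k _ k∈S a greedy (i , _ , a≡0) = a-rep , minimal
  where
  a-rep : IsRep s k a
  a-rep = greedy-isRep k∈S greedy
  k≡aᵢsᵢ : k ≡ a i * s i
  k≡aᵢsᵢ = trans (sym a-rep) (Σᶠ-single _ i λ j j≢i → cong (_* s j) (a≡0 j j≢i))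
  used≤sᵢ : ∀ b → IsRep s k b → ∀ j → 0 < b j → s j ≤ s i
  used≤sᵢ b b-rep j 0<bj with toℕ i <? toℕ j
  ... | no i≮j = increasing⇒monotone increasing j i (≮⇒≥ i≮j)
  ... | yes i<j = ⊥-elim (uncurry (greedy-positive greedy j above≡0) (used-generator-∸ s b j b-rep 0<bj)
                                  (a≡0 j λ { refl → <-irrefl refl i<j }))
    where
    above≡0 : ∀ l → toℕ j < toℕ l → a l ≡ 0
    above≡0 l j<l = a≡0 l λ { refl → <-asym i<j j<l }
  minimal : ∀ b → IsRep s k b → cost a ≤ cost b
  minimal b b-rep = subst (_≤ cost b) (sym (Σᶠ-single a i a≡0))
    (*-cancelʳ-≤ (a i) (cost b) (s i) {{>-nonZero (1≤s i)}} (begin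
      a i * s i     ≡⟨ k≡aᵢsᵢ ⟨
      k             ≡⟨ b-rep ⟨
      value s b     ≤⟨ value≤cost*bound s b (used≤sᵢ b b-rep) ⟩
      cost b * s i  ∎))
    where open ≤-Reasoning
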